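{- Let $n\ge 1$. The number of pairs $(\overline{n},(a,b))$ with $\overline{n}=(n_1,n_2)\in\mathbb{N}_{>0}^2$, $n_1+n_2=n$, and $(a,b)\in\mathbb{N}^2$ with $0\le a\le n_1$, $0\le b\le n_2$, such that for $m':=(a-1,b+1)$ or for $m':=(a+1,b-1)$ we have $(0,0)\preceq m'\preceq\overline{n}$ and $(a,b)\not\succeq m'$, equals $$\frac{n^3+6n^2-13n+6}{6}.$$
   Context: For $x,y\in\mathbb{Z}^2$, $x\preceq y$ (equivalently $y\succeq x$) means $x_1\le y_1$ and $x_2\le y_2$. These pairs are exactly the pairs $(\overline{n},\mathcal{M})$ with $\mathcal{M}$ a single row $(a,b)$ satisfying the parameterization conditions for simple games with two classes of equivalent players and one minimal winning vector. -}

module Defs where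

open import Data.Nat as ℕ using (ℕ; suc; _+_)
open import Data.Integer as ℤ using (ℤ; +_)
open import Data.Product using (_×_; _,_)
open import Data.Sum using (_⊎_)
open import Data.List using (List; upTo; cartesianProduct; filter; length)
open import Relation.Nullary using (¬_; Dec)
open import Relation.Nullary.Decidable using (_×-dec_; _⊎-dec_; ¬?)
open import Relation.Binary.PropositionalEquality using (_≡_)

ℤ² : Set
ℤ² = ℤ × ℤ

_⪯_ : ℤ² → ℤ² → Set
(x₁ , x₂) ⪯ (y₁ , y₂) = (x₁ ℤ.≤ y₁) × (x₂ ℤ.≤ y₂)

_⪯?_ : (x y : ℤ²) → Dec (x ⪯ y)
(x₁ , x₂) ⪯? (y₁ , y₂) = (x₁ ℤ.≤? y₁) ×-dec (x₂ ℤ.≤? y₂)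

_⪰_ : ℤ² → ℤ² → Set
y ⪰ x = x ⪯ y

Cand : Set
Cand = (ℕ × ℕ) × (ℕ × ℕ)

Good : ℤ² → ℤ² → ℤ² → Set
Good nbar ab m' = ((+ 0 , + 0) ⪯ m') × (m' ⪯ nbar) × ¬ (ab ⪰ m')

good? : (nbar ab m' : ℤ²) → Dec (Good nbar ab m')
good? nbar ab m' = ((+ 0 , + 0) ⪯? m') ×-dec ((m' ⪯? nbar) ×-dec ¬? (m' ⪯? ab))

Counted : ℕ → Cand → Set
Counted n ((n₁ , n₂) , (a , b)) =
  (1 ℕ.≤ n₁) × (1 ℕ.≤ n₂) × (n₁ + n₂ ≡ n) × (a ℕ.≤ n₁) × (b ℕ.≤ n₂) ×
  (Good nbar ab (A ℤ.- + 1 , B ℤ.+ + 1) ⊎ Good nbar ab (A ℤ.+ + 1 , B ℤ.- + 1))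
  where
  A = + a
  B = + b
  nbar = (+ n₁ , + n₂)
  ab = (A , B)

counted? : (n : ℕ) (c : Cand) → Dec (Counted n c)
counted? n ((n₁ , n₂) , (a , b)) =
  (1 ℕ.≤? n₁) ×-dec ((1 ℕ.≤? n₂) ×-dec ((n₁ + n₂ ℕ.≟ n) ×-dec ((a ℕ.≤? n₁) ×-dec ((b ℕ.≤? n₂) ×-dec
  (good? nbar ab (A ℤ.- + 1 , B ℤ.+ + 1) ⊎-dec good? nbar ab (A ℤ.+ + 1 , B ℤ.- + 1))))))
  where
  A = + a
  B = + b
  nbar = (+ n₁ , + n₂)
  ab = (A , B)

-- All candidates with every coordinate in {0,…,n}: a duplicate-free list
-- containing every tuple satisfying Counted n (since n₁,n₂,a,b ≤ n there).
box : ℕ → List Cand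
box n = cartesianProduct (cartesianProduct r r) (cartesianProduct r r)
  where r = upTo (suc n)

count : ℕ → ℕ
count n = length (filter (counted? n) (box n))

{-# OPTIONS --safe #-}
-- For a split n = n₁ + n₂ with n₁, n₂ ≥ 1, the vector m' = (a - 1, b + 1) meets the condition
-- exactly when a ≥ 1 and b < n₂, and m' = (a + 1, b - 1) exactly when b ≥ 1 and a < n₁.
-- Both fail only at the two corners (0, 0) and (n₁, n₂) of the rectangle [0, n₁] × [0, n₂],
-- so the split contributes (n₁ + 1)(n₂ + 1) - 2 pairs.  Summing this over n₁ = 1, …, n - 1
-- gives the cubic.
module Submission where

open import Defs

module Summation where

  open import Data.Nat using (ℕ; zero; suc; _+_; _*_; _∸_; _≤_; _<_; _≤′_; ≤′-refl; ≤′-step)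
  open import Data.Nat.Properties
  open import Data.Nat.ListAction using (sum)
  open import Data.Nat.ListAction.Properties using (sum-++)
  open import Data.List using ([]; _∷_; [_]; _++_; map; filter; length; upTo; cartesianProduct)
  open import Data.List.Properties using (map-++; map-cong; map-∘; upTo-∷ʳ)
  open import Data.Product using (_×_; _,_)
  open import Function using (_∘_)
  open import Relation.Nullary using (Dec; yes; no; ¬_; contradiction)
  open import Relation.Unary using (Pred; Decidable)
  open import Relation.Binary.PropositionalEquality hiding ([_])

  ∑< : ℕ → (ℕ → ℕ) → ℕ
  ∑< zero    f = 0
  ∑< (suc m) f = ∑< m f + f m

  syntax ∑< m (λ i → e) = ∑[ i < m ] e

  ∑<-cong : ∀ {m} {f g : ℕ → ℕ} → (∀ i → i < m → f i ≡ g i) → ∑< m f ≡ ∑< m g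
  ∑<-cong {zero}  f≗g = refl
  ∑<-cong {suc m} f≗g = cong₂ _+_ (∑<-cong (λ i i<m → f≗g i (m<n⇒m<1+n i<m))) (f≗g m ≤-refl)

  ∑<-const : ∀ m c → ∑[ _ < m ] c ≡ m * c
  ∑<-const zero    c = refl
  ∑<-const (suc m) c = trans (cong (_+ c) (∑<-const m c)) (+-comm (m * c) c)

  ∑<-vanishing : ∀ {m} {f : ℕ → ℕ} → (∀ i → i < m → f i ≡ 0) → ∑< m f ≡ 0
  ∑<-vanishing {zero}  f≗0 = refl
  ∑<-vanishing {suc m} f≗0 = cong₂ _+_ (∑<-vanishing (λ i i<m → f≗0 i (m<n⇒m<1+n i<m))) (f≗0 m ≤-refl)

  ∑<-head : ∀ m (f : ℕ → ℕ) → ∑< (suc m) f ≡ f 0 + ∑[ i < m ] f (suc i)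
  ∑<-head zero    f = +-comm 0 (f 0)
  ∑<-head (suc m) f = trans (cong (_+ f (suc m)) (∑<-head m f)) (+-assoc (f 0) _ _)

  ∑<-truncate : ∀ {k m} {f : ℕ → ℕ} → k ≤ m → (∀ i → k ≤ i → f i ≡ 0) → ∑< m f ≡ ∑< k f
  ∑<-truncate {k} {f = f} k≤m f≗0 = go (≤⇒≤′ k≤m)
    where
    go : ∀ {m} → k ≤′ m → ∑< m f ≡ ∑< k f
    go ≤′-refl          = refl
    go (≤′-step {m} k≤′m) = trans (cong₂ _+_ (go k≤′m) (f≗0 m (≤′⇒≤ k≤′m))) (+-identityʳ (∑< k f))

  ∑<-point : ∀ {t m} {f : ℕ → ℕ} → t < m → (∀ i → i ≢ t → f i ≡ 0) → ∑< m f ≡ f t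
  ∑<-point {t} {m} {f} t<m f≗0 = begin
    ∑< m f          ≡⟨ ∑<-truncate t<m (λ i t<i → f≗0 i (>⇒≢ t<i)) ⟩
    ∑< t f + f t    ≡⟨ cong (_+ f t) (∑<-vanishing (λ i i<t → f≗0 i (<⇒≢ i<t))) ⟩
    f t             ∎
    where open ≡-Reasoning

  ∑<-interval : ∀ {lo hi m} {f : ℕ → ℕ} → lo ≤ hi → hi ≤ m →
                (∀ i → i < lo → f i ≡ 0) → (∀ i → lo ≤ i → i < hi → f i ≡ 1) → (∀ i → hi ≤ i → f i ≡ 0) →
                ∑< m f ≡ hi ∸ lo
  ∑<-interval {lo} {hi} {f = f} lo≤hi hi≤m below inside above =
    trans (∑<-truncate hi≤m above) (go (≤⇒≤′ lo≤hi) ≤-refl)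
    where
    open ≡-Reasoning
    go : ∀ {h} → lo ≤′ h → h ≤ hi → ∑< h f ≡ h ∸ lo
    go ≤′-refl            _    = trans (∑<-vanishing below) (sym (n∸n≡0 lo))
    go (≤′-step {h} lo≤′h) h<hi = begin
      ∑< h f + f h    ≡⟨ cong₂ _+_ (go lo≤′h (<⇒≤ h<hi)) (inside h (≤′⇒≤ lo≤′h) h<hi) ⟩
      (h ∸ lo) + 1    ≡⟨ +-comm (h ∸ lo) 1 ⟩
      suc (h ∸ lo)    ≡⟨ +-∸-assoc 1 (≤′⇒≤ lo≤′h) ⟨
      suc h ∸ lo      ∎

  sum-map-upTo : ∀ (f : ℕ → ℕ) m → sum (map f (upTo m)) ≡ ∑< m f
  sum-map-upTo f zero    = refl
  sum-map-upTo f (suc m) = begin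
    sum (map f (upTo (suc m)))          ≡⟨ cong (sum ∘ map f) (upTo-∷ʳ m) ⟨
    sum (map f (upTo m ++ [ m ]))       ≡⟨ cong sum (map-++ f (upTo m) [ m ]) ⟩
    sum (map f (upTo m) ++ [ f m ])     ≡⟨ sum-++ (map f (upTo m)) [ f m ] ⟩
    sum (map f (upTo m)) + (f m + 0)    ≡⟨ cong₂ _+_ (sum-map-upTo f m) (+-identityʳ (f m)) ⟩
    ∑< m f + f m                        ∎
    where open ≡-Reasoning

  sum-map-cartesianProduct : ∀ {A B : Set} (f : A × B → ℕ) xs ys →
    sum (map f (cartesianProduct xs ys)) ≡ sum (map (λ x → sum (map (λ y → f (x , y)) ys)) xs)
  sum-map-cartesianProduct f []       ys = refl
  sum-map-cartesianProduct f (x ∷ xs) ys = begin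
    sum (map f (map (x ,_) ys ++ cartesianProduct xs ys))
      ≡⟨ cong sum (map-++ f (map (x ,_) ys) _) ⟩
    sum (map f (map (x ,_) ys) ++ map f (cartesianProduct xs ys))
      ≡⟨ sum-++ (map f (map (x ,_) ys)) _ ⟩
    sum (map f (map (x ,_) ys)) + sum (map f (cartesianProduct xs ys))
      ≡⟨ cong₂ _+_ (cong sum (sym (map-∘ ys))) (sum-map-cartesianProduct f xs ys) ⟩
    sum (map (λ y → f (x , y)) ys) + sum (map (λ x → sum (map (λ y → f (x , y)) ys)) xs)
      ∎
    where open ≡-Reasoning

  sum-map-square : ∀ (f : ℕ × ℕ → ℕ) m →
    sum (map f (cartesianProduct (upTo m) (upTo m))) ≡ ∑[ i < m ] ∑[ j < m ] f (i , j)
  sum-map-square f m =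
    trans (sum-map-cartesianProduct f (upTo m) (upTo m))
          (trans (cong sum (map-cong (λ i → sum-map-upTo _ m) (upTo m))) (sum-map-upTo _ m))

  𝟙 : {P : Set} → Dec P → ℕ
  𝟙 (yes _) = 1
  𝟙 (no _)  = 0

  𝟙-yes : {P : Set} (P? : Dec P) → P → 𝟙 P? ≡ 1
  𝟙-yes (yes _) p = refl
  𝟙-yes (no ¬p) p = contradiction p ¬p

  𝟙-no : {P : Set} (P? : Dec P) → ¬ P → 𝟙 P? ≡ 0
  𝟙-no (yes p) ¬p = contradiction p ¬p
  𝟙-no (no _)  ¬p = refl

  length-filter≡sum-𝟙 : ∀ {A : Set} {P : Pred A _} (P? : Decidable P) xs →
    length (filter P? xs) ≡ sum (map (𝟙 ∘ P?) xs)
  length-filter≡sum-𝟙 P? []       = refl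
  length-filter≡sum-𝟙 P? (x ∷ xs) with P? x
  ... | yes _ = cong suc (length-filter≡sum-𝟙 P? xs)
  ... | no _  = length-filter≡sum-𝟙 P? xs

module Counting where

  open Summation
  open import Data.Nat using (ℕ; zero; suc; _+_; _*_; _∸_; _≤_; _<_; z≤n; s≤s)
  open import Data.Nat.Properties
  open import Data.Nat.ListAction using (sum)
  open import Data.List using (map; upTo; cartesianProduct)
  open import Data.Integer as ℤ using (+_; +≤+)
  open import Data.Product using (_×_; _,_)
  open import Data.Sum as Sum using (_⊎_; inj₁; inj₂)
  open import Function using (_∘_; _∘′_; _⇔_; mk⇔; Equivalence)
  open import Relation.Nullary using (¬_)
  open import Relation.Binary.PropositionalEquality

  record IsSplit (n n₁ n₂ : ℕ) : Set where
    constructor mkSplit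
    field
      1≤n₁    : 1 ≤ n₁
      1≤n₂    : 1 ≤ n₂
      n₁+n₂≡n : n₁ + n₂ ≡ n

  Shiftable : ℕ → ℕ → ℕ → ℕ → Set
  Shiftable n₁ n₂ a b = (1 ≤ a × b < n₂) ⊎ (1 ≤ b × a < n₁)

  Good⁻⁺ Good⁺⁻ : ℕ → ℕ → ℕ → ℕ → Set
  Good⁻⁺ n₁ n₂ a b = Good (+ n₁ , + n₂) (+ a , + b) (+ a ℤ.- + 1 , + b ℤ.+ + 1)
  Good⁺⁻ n₁ n₂ a b = Good (+ n₁ , + n₂) (+ a , + b) (+ a ℤ.+ + 1 , + b ℤ.- + 1)

  good⁻⁺⇒ : ∀ {n₁ n₂} a b → Good⁻⁺ n₁ n₂ a b → 1 ≤ a × b < n₂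
  good⁻⁺⇒ zero    b ((() , _) , _)
  good⁻⁺⇒ {n₂ = n₂} (suc a) b (_ , (_ , +≤+ b+1≤n₂) , _) = s≤s z≤n , subst (_≤ n₂) (+-comm b 1) b+1≤n₂

  good⁻⁺⇐ : ∀ {n₁ n₂} a b → a ≤ n₁ → 1 ≤ a × b < n₂ → Good⁻⁺ n₁ n₂ a b
  good⁻⁺⇐ {n₂ = n₂} (suc a) b a≤n₁ (_ , b<n₂) =
    (+≤+ z≤n , +≤+ z≤n) , (+≤+ (≤-trans (n≤1+n a) a≤n₁) , +≤+ (subst (_≤ n₂) (+-comm 1 b) b<n₂)) ,
    λ { (_ , +≤+ b+1≤b) → m+1+n≰m b b+1≤b }

  good⁺⁻⇒ : ∀ {n₁ n₂} a b → Good⁺⁻ n₁ n₂ a b → 1 ≤ b × a < n₁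
  good⁺⁻⇒ a zero    ((_ , ()) , _)
  good⁺⁻⇒ {n₁} a (suc b) (_ , (+≤+ a+1≤n₁ , _) , _) = s≤s z≤n , subst (_≤ n₁) (+-comm a 1) a+1≤n₁

  good⁺⁻⇐ : ∀ {n₁ n₂} a b → b ≤ n₂ → 1 ≤ b × a < n₁ → Good⁺⁻ n₁ n₂ a b
  good⁺⁻⇐ {n₁} a (suc b) b≤n₂ (_ , a<n₁) =
    (+≤+ z≤n , +≤+ z≤n) , (+≤+ (subst (_≤ n₁) (+-comm 1 a) a<n₁) , +≤+ (≤-trans (n≤1+n b) b≤n₂)) ,
    λ { (+≤+ a+1≤a , _) → m+1+n≰m a a+1≤a }

  counted⇔ : ∀ {n n₁ n₂ a b} → Counted n ((n₁ , n₂) , (a , b)) ⇔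
    (IsSplit n n₁ n₂ × a ≤ n₁ × b ≤ n₂ × Shiftable n₁ n₂ a b)
  counted⇔ = mk⇔
    (λ (1≤n₁ , 1≤n₂ , sum≡n , a≤n₁ , b≤n₂ , good) →
      mkSplit 1≤n₁ 1≤n₂ sum≡n , a≤n₁ , b≤n₂ ,
      Sum.map (good⁻⁺⇒ _ _) (good⁺⁻⇒ _ _) good)
    (λ (mkSplit 1≤n₁ 1≤n₂ sum≡n , a≤n₁ , b≤n₂ , shift) →
      1≤n₁ , 1≤n₂ , sum≡n , a≤n₁ , b≤n₂ ,
      Sum.map (good⁻⁺⇐ _ _ a≤n₁) (good⁺⁻⇐ _ _ b≤n₂) shift)

  χ : ℕ → ℕ → ℕ → ℕ → ℕ → ℕ
  χ n n₁ n₂ a b = 𝟙 (counted? n ((n₁ , n₂) , (a , b)))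

  χ-yes : ∀ {n n₁ n₂ a b} → IsSplit n n₁ n₂ × a ≤ n₁ × b ≤ n₂ × Shiftable n₁ n₂ a b → χ n n₁ n₂ a b ≡ 1
  χ-yes p = 𝟙-yes (counted? _ _) (Equivalence.from counted⇔ p)

  χ-no : ∀ {n n₁ n₂ a b} → ¬ (IsSplit n n₁ n₂ × a ≤ n₁ × b ≤ n₂ × Shiftable n₁ n₂ a b) → χ n n₁ n₂ a b ≡ 0
  χ-no ¬p = 𝟙-no (counted? _ _) (¬p ∘′ Equivalence.to counted⇔)

  row : ℕ → ℕ → ℕ → ℕ → ℕ
  row n n₁ n₂ a = ∑[ b < suc n ] χ n n₁ n₂ a b

  splitCount : ℕ → ℕ → ℕ → ℕ
  splitCount n n₁ n₂ = ∑[ a < suc n ] row n n₁ n₂ a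

  count≡∑splitCount : ∀ n → count n ≡ ∑[ n₁ < suc n ] ∑[ n₂ < suc n ] splitCount n n₁ n₂
  count≡∑splitCount n = begin
    count n
      ≡⟨ length-filter≡sum-𝟙 (counted? n) (box n) ⟩
    sum (map (𝟙 ∘ counted? n) (cartesianProduct square square))
      ≡⟨ sum-map-cartesianProduct (𝟙 ∘ counted? n) square square ⟩
    sum (map (λ p → sum (map (χ′ p) square)) square)
      ≡⟨ sum-map-square (λ p → sum (map (χ′ p) square)) (suc n) ⟩
    ∑[ n₁ < suc n ] ∑[ n₂ < suc n ] sum (map (χ′ (n₁ , n₂)) square)
      ≡⟨ ∑<-cong {suc n} (λ n₁ _ → ∑<-cong {suc n} (λ n₂ _ → sum-map-square (χ′ (n₁ , n₂)) (suc n))) ⟩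
    ∑[ n₁ < suc n ] ∑[ n₂ < suc n ] splitCount n n₁ n₂
      ∎
    where
    open ≡-Reasoning
    square = cartesianProduct (upTo (suc n)) (upTo (suc n))
    χ′ : ℕ × ℕ → ℕ × ℕ → ℕ
    χ′ p q = 𝟙 (counted? n (p , q))

  splitCount-nonsplit : ∀ {n n₁ n₂} → ¬ IsSplit n n₁ n₂ → splitCount n n₁ n₂ ≡ 0
  splitCount-nonsplit {n} ¬split =
    ∑<-vanishing {suc n} (λ a _ → ∑<-vanishing {suc n} (λ b _ → χ-no (λ (split , _) → ¬split split)))

  module _ {n n₁ n₂ : ℕ} (split : IsSplit n n₁ n₂) where

    open IsSplit split

    n₁≤n : n₁ ≤ n
    n₁≤n = subst (n₁ ≤_) n₁+n₂≡n (m≤m+n n₁ n₂)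

    private
      n₂≤n : n₂ ≤ n
      n₂≤n = subst (n₂ ≤_) n₁+n₂≡n (m≤n+m n₂ n₁)

      beyond-n₂ : ∀ a b → n₂ < b → χ n n₁ n₂ a b ≡ 0
      beyond-n₂ a b n₂<b = χ-no (λ (_ , _ , b≤n₂ , _) → <⇒≱ n₂<b b≤n₂)

    row-beyond : ∀ a → n₁ < a → row n n₁ n₂ a ≡ 0
    row-beyond a n₁<a = ∑<-vanishing {suc n} (λ b _ → χ-no (λ (_ , a≤n₁ , _) → <⇒≱ n₁<a a≤n₁))

    row-first : row n n₁ n₂ 0 ≡ n₂
    row-first = ∑<-interval {m = suc n} (s≤s z≤n) (s≤s n₂≤n)
      (λ { zero _ → χ-no (λ { (_ , _ , _ , inj₁ (() , _)) ; (_ , _ , _ , inj₂ (() , _)) }) ; (suc _) (s≤s ()) })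
      (λ { (suc b) _ (s≤s 1+b≤n₂) → χ-yes (split , z≤n , 1+b≤n₂ , inj₂ (s≤s z≤n , 1≤n₁)) })
      (λ b → beyond-n₂ 0 b)

    row-inner : ∀ a → 1 ≤ a → a < n₁ → row n n₁ n₂ a ≡ suc n₂
    row-inner a 1≤a a<n₁ = ∑<-interval {m = suc n} z≤n (s≤s n₂≤n) (λ _ ())
      (λ { zero    _ _          → χ-yes (split , <⇒≤ a<n₁ , z≤n , inj₁ (1≤a , 1≤n₂))
         ; (suc b) _ (s≤s b<n₂) → χ-yes (split , <⇒≤ a<n₁ , b<n₂ , inj₂ (s≤s z≤n , a<n₁)) })
      (λ b → beyond-n₂ a b)

    row-last : row n n₁ n₂ n₁ ≡ n₂
    row-last = ∑<-interval {m = suc n} z≤n (≤-trans n₂≤n (n≤1+n n)) (λ _ ())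
      (λ b _ b<n₂ → χ-yes (split , ≤-refl , <⇒≤ b<n₂ , inj₁ (1≤n₁ , b<n₂)))
      (λ b n₂≤b → χ-no (λ { (_ , _ , _ , inj₁ (_ , b<n₂)) → <⇒≱ b<n₂ n₂≤b
                          ; (_ , _ , _ , inj₂ (_ , n₁<n₁)) → <-irrefl refl n₁<n₁ }))

  splitValue : ℕ → ℕ → ℕ
  splitValue k n₂ = n₂ + (k * suc n₂ + n₂)

  splitCount-split : ∀ {n k n₂} → IsSplit n (suc k) n₂ → splitCount n (suc k) n₂ ≡ splitValue k n₂
  splitCount-split {n} {k} {n₂} split = begin
    splitCount n (suc k) n₂
      ≡⟨ ∑<-truncate (s≤s (n₁≤n split)) (row-beyond split) ⟩
    ∑[ a < suc (suc k) ] r a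
      ≡⟨ ∑<-head (suc k) r ⟩
    r 0 + (∑[ i < k ] r (suc i) + r (suc k))
      ≡⟨ cong₂ _+_ (row-first split)
           (cong₂ _+_ (∑<-cong (λ i i<k → row-inner split (suc i) (s≤s z≤n) (s≤s i<k))) (row-last split)) ⟩
    n₂ + (∑[ _ < k ] suc n₂ + n₂)
      ≡⟨ cong (λ s → n₂ + (s + n₂)) (∑<-const k (suc n₂)) ⟩
    splitValue k n₂
      ∎
    where
    open ≡-Reasoning
    r = row n (suc k) n₂

  count-suc : ∀ m → count (suc m) ≡ ∑[ k < m ] splitValue k (m ∸ k)
  count-suc m = begin
    count n
      ≡⟨ count≡∑splitCount n ⟩
    ∑< (suc n) F
      ≡⟨ ∑<-head n F ⟩
    F 0 + (∑[ k < m ] F (suc k) + F n)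
      ≡⟨ cong₂ _+_ F-first (cong₂ _+_ (∑<-cong F-inner) F-last) ⟩
    ∑[ k < m ] splitValue k (m ∸ k) + 0
      ≡⟨ +-identityʳ _ ⟩
    ∑[ k < m ] splitValue k (m ∸ k)
      ∎
    where
    open ≡-Reasoning
    n = suc m
    F : ℕ → ℕ
    F n₁ = ∑[ n₂ < suc n ] splitCount n n₁ n₂

    F-first : F 0 ≡ 0
    F-first = ∑<-vanishing {suc n} (λ n₂ _ → splitCount-nonsplit {n} {0} {n₂} (λ { (mkSplit () _ _) }))

    F-last : F n ≡ 0
    F-last = ∑<-vanishing {suc n} (λ n₂ _ → splitCount-nonsplit {n} {n}
      (λ (mkSplit _ 1≤n₂ n+n₂≡n) → <-irrefl (sym n+n₂≡n) (m<m+n n 1≤n₂)))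

    F-inner : ∀ k → k < m → F (suc k) ≡ splitValue k (m ∸ k)
    F-inner k k<m = trans
      (∑<-point (s≤s (≤-trans (m∸n≤m m k) (n≤1+n m)))
        (λ n₂ n₂≢m∸k → splitCount-nonsplit {n} {suc k} (λ (mkSplit _ _ eq) →
          n₂≢m∸k (trans (sym (m+n∸m≡n k n₂)) (cong (_∸ k) (suc-injective eq))))))
      (splitCount-split (mkSplit (s≤s z≤n) (m<n⇒0<n∸m k<m) (cong suc (m+[n∸m]≡n (<⇒≤ k<m)))))

open Summation using (∑<)
open Counting using (splitValue; count-suc)
open import Data.Nat as ℕ using (ℕ; zero; suc; _≤_; _∸_)
import Data.Nat.Properties as ℕ
open import Data.Integer using (ℤ; +_; _+_; _-_; _*_; _^_)
open import Data.Integer.Properties using (pos-*; m-n≡m⊖n; ⊖-≥; *-distribˡ-+)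
open import Data.Integer.Tactic.RingSolver using (solve-∀)
open import Relation.Binary.PropositionalEquality using (_≡_; sym; trans; cong; cong₂; module ≡-Reasoning)

-- INLINE lets the ring solver see through closedForm.
closedForm : ℤ → ℤ → ℤ
closedForm c j = + 3 * (c - + 1) * j * (j - + 1) + + 12 * c * j - (j - + 1) * j * (+ 2 * j - + 1)
{-# INLINE closedForm #-}

closedForm-zero : ∀ c → + 0 ≡ closedForm c (+ 0)
closedForm-zero = solve-∀

closedForm-suc : ∀ c j →
  closedForm c j + + 6 * ((c - j) + (j * (+ 1 + (c - j)) + (c - j))) ≡ closedForm c (+ 1 + j)
closedForm-suc = solve-∀

closedForm-diagonal : ∀ m → let n = + 1 + m in
  closedForm m m ≡ n * (n * (n * + 1)) + + 6 * (n * (n * + 1)) - + 13 * n + + 6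
closedForm-diagonal = solve-∀

pos-∸ : ∀ {c k} → k ℕ.≤ c → + (c ∸ k) ≡ + c - + k
pos-∸ {c} {k} k≤c = sym (trans (m-n≡m⊖n c k) (⊖-≥ k≤c))

pos-splitValue : ∀ {c k} → k ℕ.≤ c →
  + splitValue k (c ∸ k) ≡ (+ c - + k) + (+ k * (+ 1 + (+ c - + k)) + (+ c - + k))
pos-splitValue {c} {k} k≤c = begin
  + splitValue k d                    ≡⟨ cong (λ x → + d + (x + + d)) (pos-* k (suc d)) ⟩
  + d + (+ k * (+ 1 + + d) + + d)     ≡⟨ cong (λ x → x + (+ k * (+ 1 + x) + x)) (pos-∸ k≤c) ⟩
  (+ c - + k) + (+ k * (+ 1 + (+ c - + k)) + (+ c - + k)) ∎
  where
  open ≡-Reasoning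
  d = c ∸ k

six∑splitValue : ∀ c j → j ℕ.≤ c → + 6 * + (∑[ k < j ] splitValue k (c ∸ k)) ≡ closedForm (+ c) (+ j)
six∑splitValue c zero    _   = closedForm-zero (+ c)
six∑splitValue c (suc j) j<c = begin
  + 6 * (+ S + + splitValue j (c ∸ j))             ≡⟨ *-distribˡ-+ (+ 6) (+ S) _ ⟩
  + 6 * + S + + 6 * + splitValue j (c ∸ j)         ≡⟨ cong₂ (λ x y → x + + 6 * y) (six∑splitValue c j j≤c) (pos-splitValue j≤c) ⟩
  closedForm (+ c) (+ j) + + 6 * _                 ≡⟨ closedForm-suc (+ c) (+ j) ⟩
  closedForm (+ c) (+ suc j)                       ∎
  where
  open ≡-Reasoning
  j≤c = ℕ.<⇒≤ j<c
  S = ∑[ k < j ] splitValue k (c ∸ k)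

mainTheorem5 : (n : ℕ) → 1 ≤ n →
    + 6 * + (count n) ≡ (+ n) ^ 3 + + 6 * (+ n) ^ 2 - + 13 * + n + + 6
mainTheorem5 (suc m) _ = begin
  + 6 * + count (suc m)                            ≡⟨ cong (λ x → + 6 * + x) (count-suc m) ⟩
  + 6 * + (∑[ k < m ] splitValue k (m ∸ k))        ≡⟨ six∑splitValue m m ℕ.≤-refl ⟩
  closedForm (+ m) (+ m)                           ≡⟨ closedForm-diagonal (+ m) ⟩
  (+ suc m) ^ 3 + + 6 * (+ suc m) ^ 2 - + 13 * + suc m + + 6 ∎
  where open ≡-Reasoning
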